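{- For every fixed positive integer $k$, $\mathrm{sat}^*(n,K_{2,k})=O(n^k)$ as $n\to\infty$.
   Context: Subsets of $[n]=\{1,\dots,n\}$ are ordered by inclusion. For finite posets $\mathcal P$ and $\mathcal Q$, $\mathcal P$ contains an induced copy of $\mathcal Q$ if there is an injective map $f:\mathcal Q\to\mathcal P$ such that for all $a,b\in\mathcal Q$, $a\le b$ if and only if $f(a)\le f(b)$. A family $\mathcal F$ of subsets of $[n]$ is $\mathcal Q$-saturated if $\mathcal F$ contains no induced copy of $\mathcal Q$, but for every $S\subseteq[n]$ with $S\notin\mathcal F$, $\mathcal F\cup\{S\}$ contains an induced copy of $\mathcal Q$. $\mathrm{sat}^*(n,\mathcal Q)$ is the minimum size of a $\mathcal Q$-saturated family of subsets of $[n]$. $K_{2,k}$ is the poset consisting of two incomparable maximal elements and $k$ pairwise incomparable minimal elements, each minimal element being below both maximal elements, with no other relations. -}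

module Defs where

open import Data.Nat using (ℕ; _≤_; _*_; _^_)
open import Data.Fin using (Fin)
open import Data.Fin.Subset using (Subset; _⊆_)
open import Data.Sum using (_⊎_; inj₁; inj₂)
open import Data.Product using (Σ; ∃; _×_; _,_)
open import Data.Unit using (⊤)
open import Data.Empty using (⊥)
open import Data.List using (List; _∷_; length)
open import Data.List.Membership.Propositional using (_∈_; _∉_)
open import Data.List.Relation.Unary.Unique.Propositional using (Unique)
open import Function using (_⇔_)
open import Function.Definitions using (Injective)
open import Relation.Binary.PropositionalEquality using (_≡_)
open import Relation.Nullary using (¬_)

-- A family of subsets of [n] is a duplicate-free list of subsets
-- (Subset n = characteristic vectors over Fin n), ordered by inclusion _⊆_.

ContainsInduced : {n : ℕ} (Q : Set) (_≤Q_ : Q → Q → Set) → List (Subset n) → Set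
ContainsInduced {n} Q _≤Q_ F =
  Σ (Q → Subset n) λ f →
    ((q : Q) → f q ∈ F) ×
    Injective _≡_ _≡_ f ×
    ((a b : Q) → (a ≤Q b) ⇔ (f a ⊆ f b))

-- The poset K_{2,k}: carrier Fin 2 ⊎ Fin k; inj₁ = the two maximal elements,
-- inj₂ = the k minimal elements; each minimal element is below both maximal ones.
K2 : ℕ → Set
K2 k = Fin 2 ⊎ Fin k

_≤K_ : {k : ℕ} → K2 k → K2 k → Set
inj₁ i ≤K inj₁ j = i ≡ j
inj₂ i ≤K inj₂ j = i ≡ j
inj₂ _ ≤K inj₁ _ = ⊤
inj₁ _ ≤K inj₂ _ = ⊥

ContainsK2k : {n : ℕ} → ℕ → List (Subset n) → Set
ContainsK2k k F = ContainsInduced (K2 k) (_≤K_ {k}) F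

K2kSaturated : {n : ℕ} → ℕ → List (Subset n) → Set
K2kSaturated {n} k F =
  ¬ ContainsK2k k F ×
  ((S : Subset n) → S ∉ F → ContainsK2k k (S ∷ F))

-- "sat*(n, K_{2,k}) ≤ m": there is a K_{2,k}-saturated family of size ≤ m
-- (sat* is the minimum size of such a family).
SatStarLe : ℕ → ℕ → ℕ → Set
SatStarLe k n m =
  Σ (List (Subset n)) λ F → Unique F × K2kSaturated k F × length F ≤ m

-- Seed with the sets [n] ∖ {x}, which contain no induced K_{2,k} (a set missing at most one
-- point has no two incomparable strict supersets), and extend greedily to a saturated family G.
-- Sets of G missing at most one point number at most n + 1. If k sets of G have the same size
-- and all miss two points x ≠ y, they form an antichain below the incomparable sets [n] ∖ {x}
-- and [n] ∖ {y}, i.e. an induced K_{2,k}. Classifying the other sets of G by their two least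
-- missing points and their size therefore gives |G| ≤ (n + 1) + n²(n + 1)(k − 1), which is
-- O(n^k) unless k = 2. For k = 2 the initial segments {0, …, a} are added to the seed: if the
-- least missing points of X ∈ G are a < b < c, then X ⊆ {0, …, a} (otherwise the two are
-- incomparable and both lie below [n] ∖ {b} and [n] ∖ {c}), so X = {0, …, a − 1}. Such sets are
-- determined by a, the others by their two missing points, and |G| ≤ (n + 1) + n² + n.
module Submission where

open import Defs
open import Data.Bool as Bool using ()
open import Data.Empty using (⊥-elim)
open import Data.Fin as Fin using (Fin; zero; suc; join; splitAt)
open import Data.Fin.Properties as Fin using (all?; splitAt-join; inject≤-injective)
open import Data.Fin.Subset
  using (Subset; inside; outside; ⁅_⁆; ∁; ∣_∣; _⊆_)
  renaming (_∈_ to _∈ₛ_; _∉_ to _∉ₛ_; ⊥ to ∅)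
open import Data.Fin.Subset.Properties
  using (_∈?_; _⊆?_; ⊆-refl; ⊆-reflexive; ⊆-antisym; x∈⁅x⁆; x∈⁅y⁆⇒x≡y; x∉p⇒x∈∁p; x∈∁p⇒x∉p; ∉⊥;
         p⊂q⇒∣p∣<∣q∣; ∣p∣≤n)
open import Data.List as List
  using (List; []; _∷_; _++_; length; filter; map; take; allFin; upTo; deduplicate;
         cartesianProductWith; cartesianProduct)
open import Data.List.Properties as List using (length-++; length-map; length-tabulate; length-upTo)
open import Data.List.Membership.Propositional using (_∈_; _∉_; find; lose)
open import Data.List.Membership.Propositional.Properties
  using (∈-filter⁺; ∈-filter⁻; ∈-allFin; ∈-map⁺; ∈-map⁻; ∈-++⁺ˡ; ∈-++⁺ʳ; ∈-++⁻; ∈-deduplicate⁺;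
         ∈-deduplicate⁻; ∈-lookup; ∈-cartesianProductWith⁺; ∈-cartesianProduct⁺; ∈-upTo⁺)
import Data.List.Membership.DecPropositional as Membership
open import Data.List.Relation.Binary.Subset.Propositional using () renaming (_⊆_ to _⊆ᴸ_)
open import Data.List.Relation.Binary.Subset.Propositional.Properties using (∷⁺ʳ)
import Data.List.Relation.Unary.All as All
open import Data.List.Relation.Unary.All.Properties.Core using (¬Any⇒All¬)
open import Data.List.Relation.Unary.AllPairs as AllPairs using (AllPairs)
import Data.List.Relation.Unary.AllPairs.Properties as AllPairs
open import Data.List.Relation.Unary.Any using (Any; here; there; any?)
open import Data.List.Relation.Unary.Unique.Propositional using (Unique)
import Data.List.Relation.Unary.Unique.Propositional.Properties as Unique
import Data.List.Relation.Unary.Unique.DecPropositional.Properties as UniqueDec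
open import Data.Nat as ℕ using (ℕ; zero; suc; _+_; _*_; _^_; _≤_; _<_; z≤n; s≤s)
import Data.Nat.Properties as ℕₚ
open import Data.Nat.Tactic.RingSolver using (solve-∀)
open import Data.Product using (Σ; ∃; ∃₂; _×_; _,_; proj₁; proj₂)
open import Data.Product.Properties as Product using (,-injectiveˡ; ,-injectiveʳ)
open import Data.Sum using (_⊎_; inj₁; inj₂; [_,_]; [_,_]′)
open import Data.Unit using (tt)
open import Data.Vec using ([]; _∷_; here; there)
import Data.Vec.Properties as Vec
open import Data.Vec.Functional as Vector using (Vector)
open import Function using (id; _∘_; case_of_; _⇔_; mk⇔; Equivalence)
open import Function.Definitions using (Injective)
open import Relation.Binary using (DecidableEquality)
open import Relation.Binary.PropositionalEquality hiding ([_])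
open import Relation.Nullary using (¬_; Dec; yes; no; ¬?; contradiction)
open import Relation.Nullary.Decidable using (map′; _×-dec_; _→-dec_)

private
  variable
    n k : ℕ

x∉∁⁅x⁆ : (x : Fin n) → x ∉ₛ ∁ ⁅ x ⁆
x∉∁⁅x⁆ x x∈ = x∈∁p⇒x∉p x∈ (x∈⁅x⁆ x)

y≢x⇒y∈∁⁅x⁆ : {x y : Fin n} → y ≢ x → y ∈ₛ ∁ ⁅ x ⁆
y≢x⇒y∈∁⁅x⁆ {x = x} y≢x = x∉p⇒x∈∁p (y≢x ∘ x∈⁅y⁆⇒x≡y x)

x∉p⇒p⊆∁⁅x⁆ : {x : Fin n} {p : Subset n} → x ∉ₛ p → p ⊆ ∁ ⁅ x ⁆
x∉p⇒p⊆∁⁅x⁆ x∉p {y} y∈p = y≢x⇒y∈∁⁅x⁆ λ { refl → x∉p y∈p }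

∉∁⁅x⁆⇒≡ : {x y : Fin n} → y ∉ₛ ∁ ⁅ x ⁆ → y ≡ x
∉∁⁅x⁆⇒≡ {x = x} {y} y∉ with y Fin.≟ x
... | yes y≡x = y≡x
... | no y≢x = contradiction (y≢x⇒y∈∁⁅x⁆ y≢x) y∉

∁⁅x⁆⊆∁⁅y⁆⇒x≡y : {x y : Fin n} → ∁ ⁅ x ⁆ ⊆ ∁ ⁅ y ⁆ → x ≡ y
∁⁅x⁆⊆∁⁅y⁆⇒x≡y s = sym (∉∁⁅x⁆⇒≡ (x∉∁⁅x⁆ _ ∘ s))

p⊆q⇒∣p∣≡∣q∣⇒p≡q : {p q : Subset n} → p ⊆ q → ∣ p ∣ ≡ ∣ q ∣ → p ≡ q
p⊆q⇒∣p∣≡∣q∣⇒p≡q {p = p} {q} p⊆q ∣p∣≡∣q∣ = ⊆-antisym p⊆q q⊆p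
  where
  q⊆p : q ⊆ p
  q⊆p {x} x∈q with x ∈? p
  ... | yes x∈p = x∈p
  ... | no x∉p = contradiction ∣p∣≡∣q∣ (ℕₚ.<⇒≢ (p⊂q⇒∣p∣<∣q∣ (p⊆q , x , x∈q , x∉p)))

atMost : Fin n → Subset n
atMost {suc n} zero = inside ∷ ∅
atMost (suc a) = inside ∷ atMost a

∈-atMost⁺ : {a z : Fin n} → z Fin.≤ a → z ∈ₛ atMost a
∈-atMost⁺ {a = zero} {zero} _ = here
∈-atMost⁺ {a = suc a} {zero} _ = here
∈-atMost⁺ {a = suc a} {suc z} (s≤s z≤a) = there (∈-atMost⁺ z≤a)

∈-atMost⁻ : {a z : Fin n} → z ∈ₛ atMost a → z Fin.≤ a
∈-atMost⁻ {z = zero} _ = z≤n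
∈-atMost⁻ {a = zero} {suc z} (there z∈∅) = contradiction z∈∅ ∉⊥
∈-atMost⁻ {a = suc a} {suc z} (there z∈) = s≤s (∈-atMost⁻ z∈)

atMost-chain : (a b : Fin n) → atMost a ⊆ atMost b ⊎ atMost b ⊆ atMost a
atMost-chain a b with ℕₚ.≤-total (Fin.toℕ a) (Fin.toℕ b)
... | inj₁ a≤b = inj₁ λ z∈ → ∈-atMost⁺ (ℕₚ.≤-trans (∈-atMost⁻ z∈) a≤b)
... | inj₂ b≤a = inj₂ λ z∈ → ∈-atMost⁺ (ℕₚ.≤-trans (∈-atMost⁻ z∈) b≤a)

missing : Subset n → List (Fin n)
missing p = filter (λ x → ¬? (x ∈? p)) (allFin _)

∈-missing⁺ : {p : Subset n} {x : Fin n} → x ∉ₛ p → x ∈ missing p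
∈-missing⁺ {p = p} {x} x∉p = ∈-filter⁺ (λ x → ¬? (x ∈? p)) (∈-allFin x) x∉p

∈-missing⁻ : {p : Subset n} {x : Fin n} → x ∈ missing p → x ∉ₛ p
∈-missing⁻ {p = p} x∈ = proj₂ (∈-filter⁻ (λ x → ¬? (x ∈? p)) {xs = allFin _} x∈)

missing-sorted : (p : Subset n) → AllPairs Fin._<_ (missing p)
missing-sorted p =
  AllPairs.filter⁺ (λ x → ¬? (x ∈? p)) {xs = allFin _} (AllPairs.tabulate⁺-< {f = id} (λ i<j → i<j))

missing-injective : {p q : Subset n} → missing p ≡ missing q → p ≡ q
missing-injective {p = p} {q} eq = ⊆-antisym (⊆-from eq) (⊆-from (sym eq))
  where
  ⊆-from : {p q : Subset n} → missing p ≡ missing q → p ⊆ q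
  ⊆-from {p = p} {q} eq {x} x∈p with x ∈? q
  ... | yes x∈q = x∈q
  ... | no x∉q = contradiction x∈p (∈-missing⁻ (subst (x ∈_) (sym eq) (∈-missing⁺ x∉q)))

-- Induced copies of K_{2,k}

IsEmbedding : (Q : Set) (_≤Q_ : Q → Q → Set) → (Q → Subset n) → Set
IsEmbedding Q _≤Q_ f = Injective _≡_ _≡_ f × ((a b : Q) → (a ≤Q b) ⇔ (f a ⊆ f b))

IsAntichain : Vector (Subset n) k → Set
IsAntichain g = ∀ i j → g i ⊆ g j → i ≡ j

≤K-antisym : {a b : K2 k} → a ≤K b → b ≤K a → a ≡ b
≤K-antisym {a = inj₁ i} {inj₁ j} refl _ = refl
≤K-antisym {a = inj₂ i} {inj₂ j} refl _ = refl
≤K-antisym {a = inj₂ i} {inj₁ j} _ ()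

K2-embedding : (t : Vector (Subset n) 2) (g : Vector (Subset n) k) →
  IsAntichain t → IsAntichain g → (∀ i j → g i ⊆ t j) → (∀ i j → ¬ t j ⊆ g i) →
  IsEmbedding (K2 k) _≤K_ [ t , g ]′
K2-embedding t g t-anti g-anti g⊆t t⊈g = injective , order
  where
  order : ∀ a b → (a ≤K b) ⇔ ([ t , g ]′ a ⊆ [ t , g ]′ b)
  order (inj₁ i) (inj₁ j) = mk⇔ (λ { refl → ⊆-refl }) (t-anti i j)
  order (inj₂ i) (inj₂ j) = mk⇔ (λ { refl → ⊆-refl }) (g-anti i j)
  order (inj₂ i) (inj₁ j) = mk⇔ (λ _ {_} → g⊆t i j) (λ _ → tt)
  order (inj₁ i) (inj₂ j) = mk⇔ (λ ()) (λ t⊆g → contradiction t⊆g (t⊈g j i))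
  injective : Injective _≡_ _≡_ [ t , g ]′
  injective {a} {b} e =
    ≤K-antisym (Equivalence.from (order a b) (⊆-reflexive e)) (Equivalence.from (order b a) (⊆-reflexive (sym e)))

containsK2k-fromAntichain : {F : List (Subset n)} {x y : Fin n} → x ≢ y → ∁ ⁅ x ⁆ ∈ F → ∁ ⁅ y ⁆ ∈ F →
  (g : Vector (Subset n) k) → (∀ i → g i ∈ F) → IsAntichain g → (∀ i → x ∉ₛ g i × y ∉ₛ g i) →
  ContainsK2k k F
containsK2k-fromAntichain {n = n} {F = F} {x} {y} x≢y ∁x∈F ∁y∈F g g∈F g-anti g-misses =
  [ t , g ]′ , [ t∈F , g∈F ] , K2-embedding t g t-anti g-anti g⊆t t⊈g
  where
  t : Vector (Subset n) 2
  t = ∁ ⁅ x ⁆ Vector.∷ ∁ ⁅ y ⁆ Vector.∷ Vector.[]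
  t∈F : ∀ i → t i ∈ F
  t∈F zero = ∁x∈F
  t∈F (suc zero) = ∁y∈F
  t-anti : IsAntichain t
  t-anti zero zero _ = refl
  t-anti zero (suc zero) s = contradiction (∁⁅x⁆⊆∁⁅y⁆⇒x≡y s) x≢y
  t-anti (suc zero) zero s = contradiction (sym (∁⁅x⁆⊆∁⁅y⁆⇒x≡y s)) x≢y
  t-anti (suc zero) (suc zero) _ = refl
  g⊆t : ∀ i j → g i ⊆ t j
  g⊆t i zero = x∉p⇒p⊆∁⁅x⁆ (proj₁ (g-misses i))
  g⊆t i (suc zero) = x∉p⇒p⊆∁⁅x⁆ (proj₂ (g-misses i))
  t⊈g : ∀ i j → ¬ t j ⊆ g i
  t⊈g i zero s = proj₂ (g-misses i) (s (y≢x⇒y∈∁⁅x⁆ (x≢y ∘ sym)))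
  t⊈g i (suc zero) s = proj₁ (g-misses i) (s (y≢x⇒y∈∁⁅x⁆ x≢y))

MissesAtMostOne : Subset n → Set
MissesAtMostOne p = ∀ {x y} → x ∉ₛ p → y ∉ₛ p → x ≡ y

missesAtMostOne-⊂⇒full : {p q : Subset n} → MissesAtMostOne p → p ⊆ q → p ≢ q → ∀ z → z ∈ₛ q
missesAtMostOne-⊂⇒full {p = p} {q} p-one p⊆q p≢q z with z ∈? q
... | yes z∈q = z∈q
... | no z∉q = contradiction (⊆-antisym p⊆q q⊆p) p≢q
  where
  q⊆p : q ⊆ p
  q⊆p {w} w∈q with w ∈? p
  ... | yes w∈p = w∈p
  ... | no w∉p = contradiction (subst (_∈ₛ q) (p-one w∉p (z∉q ∘ p⊆q)) w∈q) z∉q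

bottom-missesTwo : {f : K2 k → Subset n} → IsEmbedding (K2 k) _≤K_ f → ∀ i → ¬ MissesAtMostOne (f (inj₂ i))
bottom-missesTwo {f = f} (f-inj , f-ord) i bottom-one =
  case Equivalence.from (f-ord (inj₁ zero) (inj₁ (suc zero))) (λ {z} _ → top-full (suc zero) z) of λ ()
  where
  top-full : ∀ t z → z ∈ₛ f (inj₁ t)
  top-full t = missesAtMostOne-⊂⇒full bottom-one (Equivalence.to (f-ord (inj₂ i) (inj₁ t)) tt)
                 (λ e → case f-inj e of λ ())

∁⁅x⁆-missesAtMostOne : (x : Fin n) → MissesAtMostOne (∁ ⁅ x ⁆)
∁⁅x⁆-missesAtMostOne x y∉ z∉ = trans (∉∁⁅x⁆⇒≡ y∉) (sym (∉∁⁅x⁆⇒≡ z∉))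

missesAtMostOne⇒K2k-free : {F : List (Subset n)} → (∀ {X} → X ∈ F → MissesAtMostOne X) → ¬ ContainsK2k (suc k) F
missesAtMostOne⇒K2k-free F-one (f , f∈F , f-emb) = bottom-missesTwo f-emb zero (F-one (f∈F (inj₂ zero)))

chainOrMissesAtMostOne⇒K2k-free : {F : List (Subset n)} (Chain : Subset n → Set) →
  (∀ {X Y} → Chain X → Chain Y → X ⊆ Y ⊎ Y ⊆ X) →
  (∀ {X} → X ∈ F → MissesAtMostOne X ⊎ Chain X) → ¬ ContainsK2k (suc (suc k)) F
chainOrMissesAtMostOne⇒K2k-free Chain chain F-shape (f , f∈F , f-emb@(_ , f-ord))
  with F-shape (f∈F (inj₂ zero)) | F-shape (f∈F (inj₂ (suc zero)))
... | inj₁ one | _ = bottom-missesTwo f-emb zero one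
... | _ | inj₁ one = bottom-missesTwo f-emb (suc zero) one
... | inj₂ chain₀ | inj₂ chain₁ with chain chain₀ chain₁
...   | inj₁ f₀⊆f₁ = case Equivalence.from (f-ord (inj₂ zero) (inj₂ (suc zero))) f₀⊆f₁ of λ ()
...   | inj₂ f₁⊆f₀ = case Equivalence.from (f-ord (inj₂ (suc zero)) (inj₂ zero)) f₁⊆f₀ of λ ()

punctured : ∀ n → List (Subset n)
punctured n = map (λ x → ∁ ⁅ x ⁆) (allFin n)

∁⁅x⁆∈punctured : (x : Fin n) → ∁ ⁅ x ⁆ ∈ punctured n
∁⁅x⁆∈punctured x = ∈-map⁺ (λ x → ∁ ⁅ x ⁆) (∈-allFin x)

punctured-missesAtMostOne : ∀ {X} → X ∈ punctured n → MissesAtMostOne X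
punctured-missesAtMostOne X∈ with ∈-map⁻ (λ x → ∁ ⁅ x ⁆) X∈
... | x , _ , refl = ∁⁅x⁆-missesAtMostOne x

-- Greedy saturation

_⇔-dec_ : {A B : Set} → Dec A → Dec B → Dec (A ⇔ B)
a? ⇔-dec b? =
  map′ (λ (f , g) → mk⇔ f g) (λ e → Equivalence.to e , Equivalence.from e) ((a? →-dec b?) ×-dec (b? →-dec a?))

_≟ₛ_ : DecidableEquality (Subset n)
_≟ₛ_ = Vec.≡-dec Bool._≟_

∃-Vector? : {A : Set} (xs : List A) (m : ℕ) {P : Vector A m → Set} →
  (∀ {f g} → f ≗ g → P f → P g) → (∀ f → Dec (P f)) → Dec (∃ λ f → (∀ i → f i ∈ xs) × P f)
∃-Vector? xs zero resp P? =
  map′ (λ p → Vector.[] , (λ ()) , p) (λ (f , _ , p) → resp (λ ()) p) (P? Vector.[])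
∃-Vector? {A = A} xs (suc m) {P} resp P? =
  map′ fromAny toAny (any? (λ x → ∃-Vector? xs m (resp ∘ ∷-cong x) (P? ∘ (x Vector.∷_))) xs)
  where
  ∷-cong : ∀ x {f g : Vector A m} → f ≗ g → (x Vector.∷ f) ≗ (x Vector.∷ g)
  ∷-cong x f≗g zero = refl
  ∷-cong x f≗g (suc i) = f≗g i
  fromAny : Any (λ x → ∃ λ f → (∀ i → f i ∈ xs) × P (x Vector.∷ f)) xs →
    ∃ λ f → (∀ i → f i ∈ xs) × P f
  fromAny any with find any
  ... | x , x∈ , f , f∈ , p = x Vector.∷ f , (λ { zero → x∈ ; (suc i) → f∈ i }) , p
  toAny : (∃ λ f → (∀ i → f i ∈ xs) × P f) →
    Any (λ x → ∃ λ f → (∀ i → f i ∈ xs) × P (x Vector.∷ f)) xs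
  toAny (f , f∈ , p) = lose (f∈ zero) (Vector.tail f , f∈ ∘ suc , resp (λ { zero → refl ; (suc i) → refl }) p)

⊆-resp : {p p′ q q′ : Subset n} → p ≡ p′ → q ≡ q′ → p ⊆ q → p′ ⊆ q′
⊆-resp refl refl p⊆q = p⊆q

IsEmbedding-resp : {Q : Set} {_≤Q_ : Q → Q → Set} {f g : Q → Subset n} → f ≗ g →
  IsEmbedding Q _≤Q_ f → IsEmbedding Q _≤Q_ g
IsEmbedding-resp {_≤Q_ = _≤Q_} {f} {g} f≗g (f-inj , f-ord) = g-inj , g-ord
  where
  g-inj : Injective _≡_ _≡_ g
  g-inj {a} {b} e = f-inj (trans (f≗g a) (trans e (sym (f≗g b))))
  g-ord : ∀ a b → (a ≤Q b) ⇔ (g a ⊆ g b)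
  g-ord a b = mk⇔ (⊆-resp (f≗g a) (f≗g b) ∘ Equivalence.to (f-ord a b))
                  (Equivalence.from (f-ord a b) ∘ ⊆-resp (sym (f≗g a)) (sym (f≗g b)))

containsInduced? : {Q : Set} {_≤Q_ : Q → Q → Set} → (∀ a b → Dec (a ≤Q b)) →
  {m : ℕ} (to : Q → Fin m) (from : Fin m → Q) → (∀ q → from (to q) ≡ q) →
  (F : List (Subset n)) → Dec (ContainsInduced Q _≤Q_ F)
containsInduced? {n = n} {Q = Q} {_≤Q_} _≤Q?_ to from from∘to F =
  map′ (λ (h , h∈ , e) → h ∘ to , h∈ ∘ to , e)
       (λ (f , f∈ , e) → f ∘ from , f∈ ∘ from , IsEmbedding-resp (λ q → cong f (sym (from∘to q))) e)
       (∃-Vector? F _ (λ h≗h′ → IsEmbedding-resp (h≗h′ ∘ to)) (isEmbedding? ∘ (_∘ to)))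
  where
  ∀? : {R : Q → Set} → (∀ q → Dec (R q)) → Dec (∀ q → R q)
  ∀? {R} R? = map′ (λ h q → subst R (from∘to q) (h (to q))) (λ h i → h (from i)) (all? (R? ∘ from))
  _≟Q_ : DecidableEquality Q
  a ≟Q b = map′ (λ e → trans (sym (from∘to a)) (trans (cong from e) (from∘to b))) (cong to) (to a Fin.≟ to b)
  isEmbedding? : (f : Q → Subset n) → Dec (IsEmbedding Q _≤Q_ f)
  isEmbedding? f =
    map′ (λ inj {a} {b} → inj a b) (λ inj a b → inj) (∀? λ a → ∀? λ b → (f a ≟ₛ f b) →-dec (a ≟Q b))
    ×-dec ∀? λ a → ∀? λ b → (a ≤Q? b) ⇔-dec (f a ⊆? f b)

_≤K?_ : (a b : K2 k) → Dec (a ≤K b)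
inj₁ i ≤K? inj₁ j = i Fin.≟ j
inj₂ i ≤K? inj₂ j = i Fin.≟ j
inj₂ _ ≤K? inj₁ _ = yes tt
inj₁ _ ≤K? inj₂ _ = no λ ()

containsK2k? : (k : ℕ) (F : List (Subset n)) → Dec (ContainsK2k k F)
containsK2k? k = containsInduced? _≤K?_ (join 2 k) (splitAt 2) (splitAt-join 2 k)

containsInduced-mono : {Q : Set} {_≤Q_ : Q → Q → Set} {F G : List (Subset n)} → F ⊆ᴸ G →
  ContainsInduced Q _≤Q_ F → ContainsInduced Q _≤Q_ G
containsInduced-mono F⊆G (f , f∈F , e) = f , F⊆G ∘ f∈F , e

allSubsets : ∀ n → List (Subset n)
allSubsets zero = [] ∷ []
allSubsets (suc n) = map (inside ∷_) (allSubsets n) ++ map (outside ∷_) (allSubsets n)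

∈-allSubsets : (p : Subset n) → p ∈ allSubsets n
∈-allSubsets [] = here refl
∈-allSubsets {suc n} (inside ∷ p) = ∈-++⁺ˡ (∈-map⁺ (inside ∷_) (∈-allSubsets p))
∈-allSubsets {suc n} (outside ∷ p) =
  ∈-++⁺ʳ (map (inside ∷_) (allSubsets n)) (∈-map⁺ (outside ∷_) (∈-allSubsets p))

module Saturation {A : Set} (_≟_ : DecidableEquality A) {P : List A → Set} (P? : ∀ xs → Dec (P xs))
                  (P-mono : ∀ {xs ys} → xs ⊆ᴸ ys → P xs → P ys) where

  record Extension (todo seed : List A) : Set where
    field
      family : List A
      seed⊆family : seed ⊆ᴸ family
      unique : Unique family
      free : ¬ P family
      covers : ∀ {S} → S ∈ todo → S ∈ family ⊎ P (S ∷ family)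

  cover : ∀ {S todo seed} → (∀ {G} → seed ⊆ᴸ G → S ∈ G ⊎ P (S ∷ G)) →
    Extension todo seed → Extension (S ∷ todo) seed
  cover covers-S E = record
    { family = E.family ; seed⊆family = E.seed⊆family ; unique = E.unique ; free = E.free
    ; covers = λ { (here refl) → covers-S E.seed⊆family ; (there S∈) → E.covers S∈ } }
    where module E = Extension E

  shrink : ∀ {todo seed seed′} → seed′ ⊆ᴸ seed → Extension todo seed → Extension todo seed′
  shrink seed′⊆seed E = record
    { family = E.family ; seed⊆family = E.seed⊆family ∘ seed′⊆seed ; unique = E.unique ; free = E.free
    ; covers = E.covers }
    where module E = Extension E

  extend : (todo seed : List A) → Unique seed → ¬ P seed → Extension todo seed
  extend [] seed unique free = record { family = seed ; seed⊆family = id ; unique = unique ; free = free ; covers = λ () }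
  extend (S ∷ todo) seed unique free with Membership._∈?_ _≟_ S seed | P? (S ∷ seed)
  ... | yes S∈seed | _ = cover (λ seed⊆G → inj₁ (seed⊆G S∈seed)) (extend todo seed unique free)
  ... | no _ | yes P[S∷seed] =
    cover (λ seed⊆G → inj₂ (P-mono (∷⁺ʳ S seed⊆G) P[S∷seed])) (extend todo seed unique free)
  ... | no S∉seed | no ¬P[S∷seed] =
    shrink there (cover (λ S∷seed⊆G → inj₁ (S∷seed⊆G (here refl)))
      (extend todo (S ∷ seed) (¬Any⇒All¬ seed S∉seed AllPairs.∷ unique) ¬P[S∷seed]))

  saturate : (universe : List A) → (∀ S → S ∈ universe) → (seed : List A) → ¬ P seed →
    Σ (List A) λ G → seed ⊆ᴸ G × Unique G × ¬ P G × (∀ S → S ∉ G → P (S ∷ G))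
  saturate universe ∈-universe seed free =
    E.family , E.seed⊆family ∘ ∈-deduplicate⁺ _≟_ , E.unique , E.free , saturated
    where
    E = extend universe (deduplicate _≟_ seed) (UniqueDec.deduplicate-! _≟_ seed)
          (free ∘ P-mono (∈-deduplicate⁻ _≟_ seed))
    module E = Extension E
    saturated : ∀ S → S ∉ E.family → P (S ∷ E.family)
    saturated S S∉G with E.covers (∈-universe S)
    ... | inj₁ S∈G = contradiction S∈G S∉G
    ... | inj₂ P[S∷G] = P[S∷G]

-- Counting

length-filter+length-filter¬ : {A : Set} {P : A → Set} (P? : ∀ x → Dec (P x)) (xs : List A) →
  length (filter P? xs) + length (filter (¬? ∘ P?) xs) ≡ length xs
length-filter+length-filter¬ P? [] = refl
length-filter+length-filter¬ P? (x ∷ xs) with P? x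
... | yes _ = cong suc (length-filter+length-filter¬ P? xs)
... | no _ = trans (ℕₚ.+-suc _ _) (cong suc (length-filter+length-filter¬ P? xs))

length≤fibres : {A C : Set} → DecidableEquality C → (code : A → C) {R : A → Set} (b : ℕ) →
  (∀ c (M : List A) → Unique M → (∀ {x} → x ∈ M → R x) → (∀ {x} → x ∈ M → code x ≡ c) →
    length M ≤ b) →
  (cs : List C) (xs : List A) → Unique xs → (∀ {x} → x ∈ xs → R x) → (∀ {x} → x ∈ xs → code x ∈ cs) →
  length xs ≤ length cs * b
length≤fibres _≟_ code b fibre [] [] _ _ _ = z≤n
length≤fibres _≟_ code b fibre [] (x ∷ xs) _ _ code∈ with code∈ (here refl)
... | ()
length≤fibres {A = A} _≟_ code {R} b fibre (c ∷ cs) xs xs-unique xs-R code∈ = begin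
  length xs                                    ≡⟨ sym (length-filter+length-filter¬ over-c xs) ⟩
  length (filter over-c xs) + length (filter (¬? ∘ over-c) xs)
    ≤⟨ ℕₚ.+-mono-≤ (fibre c _ (Unique.filter⁺ over-c xs-unique) (xs-R ∘ in-xs over-c)
                      (proj₂ ∘ ∈-filter⁻ over-c {xs = xs}))
                   (length≤fibres _≟_ code b fibre cs _ (Unique.filter⁺ (¬? ∘ over-c) xs-unique)
                      (xs-R ∘ in-xs (¬? ∘ over-c)) code∈cs) ⟩
  b + length cs * b                            ∎
  where
  open ℕₚ.≤-Reasoning
  over-c : ∀ x → Dec (code x ≡ c)
  over-c x = code x ≟ c
  in-xs : {P : A → Set} (P? : ∀ x → Dec (P x)) → ∀ {x} → x ∈ filter P? xs → x ∈ xs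
  in-xs P? = proj₁ ∘ ∈-filter⁻ P? {xs = xs}
  code∈cs : ∀ {x} → x ∈ filter (¬? ∘ over-c) xs → code x ∈ cs
  code∈cs x∈ with code∈ (in-xs (¬? ∘ over-c) x∈)
  ... | here code≡c = contradiction code≡c (proj₂ (∈-filter⁻ (¬? ∘ over-c) {xs = xs} x∈))
  ... | there code∈cs = code∈cs

length≤1 : {A : Set} (xs : List A) → Unique xs → (∀ {x y} → x ∈ xs → y ∈ xs → x ≡ y) → length xs ≤ 1
length≤1 [] _ _ = z≤n
length≤1 (x ∷ []) _ _ = s≤s z≤n
length≤1 (x ∷ y ∷ xs) ((x≢y All.∷ _) AllPairs.∷ _) all-equal =
  contradiction (all-equal (here refl) (there (here refl))) x≢y

lookup-injective : {A : Set} {xs : List A} → Unique xs → ∀ {i j} → List.lookup xs i ≡ List.lookup xs j → i ≡ j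
lookup-injective {xs = x ∷ xs} _ {zero} {zero} _ = refl
lookup-injective {xs = x ∷ xs} (x∉xs AllPairs.∷ _) {zero} {suc j} x≡ =
  contradiction x≡ (All.lookup x∉xs (∈-lookup j))
lookup-injective {xs = x ∷ xs} (x∉xs AllPairs.∷ _) {suc i} {zero} ≡x =
  contradiction (sym ≡x) (All.lookup x∉xs (∈-lookup i))
lookup-injective {xs = x ∷ xs} (_ AllPairs.∷ xs-unique) {suc i} {suc j} eq = cong suc (lookup-injective xs-unique eq)

length-cartesianProductWith : {A B C : Set} (f : A → B → C) (xs : List A) (ys : List B) →
  length (cartesianProductWith f xs ys) ≡ length xs * length ys
length-cartesianProductWith f [] ys = refl
length-cartesianProductWith f (x ∷ xs) ys =
  trans (length-++ (map (f x) ys)) (cong₂ _+_ (length-map (f x) ys) (length-cartesianProductWith f xs ys))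

sameSizeMissingBoth-length< : {F : List (Subset n)} → ¬ ContainsK2k k F →
  {x y : Fin n} → x ≢ y → ∁ ⁅ x ⁆ ∈ F → ∁ ⁅ y ⁆ ∈ F → {s : ℕ} (M : List (Subset n)) → Unique M →
  (∀ {X} → X ∈ M → X ∈ F) → (∀ {X} → X ∈ M → x ∉ₛ X × y ∉ₛ X × ∣ X ∣ ≡ s) → length M < k
sameSizeMissingBoth-length< {n = n} {k = k} F-free x≢y ∁x∈F ∁y∈F {s} M M-unique M⊆F M-shape with k ℕ.≤? length M
... | no k≰ = ℕₚ.≰⇒> k≰
... | yes k≤ = contradiction
      (containsK2k-fromAntichain x≢y ∁x∈F ∁y∈F g (M⊆F ∘ g∈M) g-anti
        (λ i → let x∉ , y∉ , _ = M-shape (g∈M i) in x∉ , y∉))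
      F-free
  where
  g : Vector (Subset n) k
  g i = List.lookup M (Fin.inject≤ i k≤)
  g∈M : ∀ i → g i ∈ M
  g∈M i = ∈-lookup (Fin.inject≤ i k≤)
  size : ∀ i → ∣ g i ∣ ≡ s
  size i = proj₂ (proj₂ (M-shape (g∈M i)))
  g-anti : IsAntichain g
  g-anti i j gi⊆gj =
    inject≤-injective k≤ k≤ i j (lookup-injective M-unique (p⊆q⇒∣p∣≡∣q∣⇒p≡q gi⊆gj (trans (size i) (sym (size j)))))

length≤1+n : (M : List (Subset n)) → Unique M → (∀ {X} → X ∈ M → length (missing X) ≤ 1) → length M ≤ suc n
length≤1+n {n = n} M M-unique M-short =
  subst (length M ≤_) length-short (length≤fibres (List.≡-dec Fin._≟_) missing 1 fibre short M M-unique M-short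
    (λ X∈ → short-complete _ (M-short X∈)))
  where
  short : List (List (Fin n))
  short = [] ∷ map (_∷ []) (allFin n)
  short-complete : (l : List (Fin n)) → length l ≤ 1 → l ∈ short
  short-complete [] _ = here refl
  short-complete (a ∷ []) _ = there (∈-map⁺ (_∷ []) (∈-allFin a))
  short-complete (_ ∷ _ ∷ _) (s≤s ())
  length-short : length short * 1 ≡ suc n
  length-short = trans (ℕₚ.*-identityʳ _) (cong suc (trans (length-map _ (allFin n)) (length-tabulate id)))
  fibre : ∀ l N → Unique N → (∀ {X} → X ∈ N → length (missing X) ≤ 1) → (∀ {X} → X ∈ N → missing X ≡ l) →
    length N ≤ 1
  fibre l N N-unique _ N-l = length≤1 N N-unique λ X∈ Y∈ → missing-injective (trans (N-l X∈) (sym (N-l Y∈)))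

length≤1+n+missingTwo : (G : List (Subset n)) → Unique G → {m : ℕ} →
  ((M : List (Subset n)) → Unique M → (∀ {X} → X ∈ M → X ∈ G) →
    (∀ {X} → X ∈ M → 2 ≤ length (missing X)) → length M ≤ m) →
  length G ≤ suc n + m
length≤1+n+missingTwo {n = n} G G-unique {m} bound = begin
  length G                                            ≡⟨ sym (length-filter+length-filter¬ short? G) ⟩
  length (filter short? G) + length (filter (¬? ∘ short?) G)
    ≤⟨ ℕₚ.+-mono-≤ (length≤1+n _ (Unique.filter⁺ short? G-unique) (proj₂ ∘ ∈-filter⁻ short? {xs = G}))
                   (bound _ (Unique.filter⁺ (¬? ∘ short?) G-unique) (proj₁ ∘ ∈-filter⁻ (¬? ∘ short?) {xs = G})
                      (ℕₚ.≰⇒> ∘ proj₂ ∘ ∈-filter⁻ (¬? ∘ short?) {xs = G})) ⟩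
  suc n + m                                           ∎
  where
  open ℕₚ.≤-Reasoning
  short? : ∀ X → Dec (length (missing X) ≤ 1)
  short? X = length (missing X) ℕ.≤? 1

take₂-shape : {A : Set} (l : List A) → 2 ≤ length l → ∃₂ λ a b → take 2 l ≡ a ∷ b ∷ []
take₂-shape (a ∷ b ∷ _) _ = a , b , refl
take₂-shape (_ ∷ []) (s≤s ())

take₂-missing : (X : Subset n) {a b : Fin n} → take 2 (missing X) ≡ a ∷ b ∷ [] →
  a ∉ₛ X × b ∉ₛ X × a Fin.< b
take₂-missing X eq with missing X in missing≡ | missing-sorted X
... | a ∷ b ∷ _ | (a<b All.∷ _) AllPairs.∷ _ with refl ← eq =
  ∈-missing⁻ (subst (a ∈_) (sym missing≡) (here refl)) ,
  ∈-missing⁻ (subst (b ∈_) (sym missing≡) (there (here refl))) , a<b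

pairs : ∀ n → List (List (Fin n))
pairs n = cartesianProductWith (λ a b → a ∷ b ∷ []) (allFin n) (allFin n)

take₂∈pairs : (l : List (Fin n)) → 2 ≤ length l → take 2 l ∈ pairs n
take₂∈pairs (a ∷ b ∷ _) _ = ∈-cartesianProductWith⁺ (λ a b → a ∷ b ∷ []) (∈-allFin a) (∈-allFin b)
take₂∈pairs (_ ∷ []) (s≤s ())

length-pairs : length (pairs n) ≡ n * n
length-pairs {n = n} =
  trans (length-cartesianProductWith (λ a b → a ∷ b ∷ []) (allFin n) (allFin n))
        (cong₂ _*_ (length-tabulate {n = n} id) (length-tabulate {n = n} id))

missingTwo-length≤ : {G : List (Subset n)} → ¬ ContainsK2k (suc k) G → (∀ x → ∁ ⁅ x ⁆ ∈ G) →
  (M : List (Subset n)) → Unique M → (∀ {X} → X ∈ M → X ∈ G) → (∀ {X} → X ∈ M → 2 ≤ length (missing X)) →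
  length M ≤ n * n * suc n * k
missingTwo-length≤ {n = n} {k} {G} G-free ∁∈G M M-unique M⊆G M-two =
  subst (length M ≤_) (cong (_* k) length-codes)
    (length≤fibres (Product.≡-dec (List.≡-dec Fin._≟_) ℕ._≟_) code k fibre codes M M-unique
      (λ X∈ → M⊆G X∈ , M-two X∈)
      λ {X} X∈ → ∈-cartesianProduct⁺ (take₂∈pairs (missing X) (M-two X∈)) (∈-upTo⁺ (s≤s (∣p∣≤n X))))
  where
  code : Subset n → List (Fin n) × ℕ
  code X = take 2 (missing X) , ∣ X ∣
  codes : List (List (Fin n) × ℕ)
  codes = cartesianProduct (pairs n) (upTo (suc n))
  length-codes : length codes ≡ n * n * suc n
  length-codes = trans (length-cartesianProductWith _,_ (pairs n) (upTo (suc n)))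
                       (cong₂ _*_ (length-pairs {n = n}) (length-upTo (suc n)))
  fibre : ∀ c N → Unique N → (∀ {X} → X ∈ N → X ∈ G × 2 ≤ length (missing X)) →
    (∀ {X} → X ∈ N → code X ≡ c) → length N ≤ k
  fibre c [] _ _ _ = z≤n
  fibre c N@(X ∷ _) N-unique N-R N-c with take₂-shape (missing X) (proj₂ (N-R (here refl)))
  ... | a , b , take₂≡ =
    ℕₚ.≤-pred
      (sameSizeMissingBoth-length< G-free (Fin.<⇒≢ a<b) (∁∈G a) (∁∈G b) N N-unique (proj₁ ∘ N-R) shape)
    where
    a<b : a Fin.< b
    a<b = proj₂ (proj₂ (take₂-missing X take₂≡))
    shape : ∀ {Y} → Y ∈ N → a ∉ₛ Y × b ∉ₛ Y × ∣ Y ∣ ≡ ∣ X ∣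
    shape {Y} Y∈ =
      let Y≡X = trans (N-c Y∈) (sym (N-c (here refl)))
          a∉ , b∉ , _ = take₂-missing Y (trans (,-injectiveˡ Y≡X) take₂≡)
      in a∉ , b∉ , ,-injectiveʳ Y≡X

-- Initial segments and K_{2,2}

⊆atMost⇒∈⇔< : {X : Subset n} {a : Fin n} → X ⊆ atMost a → a ∉ₛ X → (∀ {z} → z ∉ₛ X → a Fin.≤ z) →
  ∀ {z} → z ∈ₛ X ⇔ z Fin.< a
⊆atMost⇒∈⇔< {X = X} {a} X⊆ a∉X a-least {z} = mk⇔
  (λ z∈X → ℕₚ.≤∧≢⇒< (∈-atMost⁻ (X⊆ z∈X)) λ z≡a →
     a∉X (subst (_∈ₛ X) (Fin.toℕ-injective z≡a) z∈X))
  λ z<a → case z ∈? X of λ { (yes z∈X) → z∈X ; (no z∉X) → contradiction (a-least z∉X) (ℕₚ.<⇒≱ z<a) }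

missingThree⇒⊆atMost : {G : List (Subset n)} → ¬ ContainsK2k 2 G → (∀ x → ∁ ⁅ x ⁆ ∈ G) →
  {X : Subset n} → X ∈ G → {a b c : Fin n} → atMost a ∈ G → a ∉ₛ X → b ∉ₛ X → c ∉ₛ X →
  a Fin.< b → a Fin.< c → b ≢ c → X ⊆ atMost a
missingThree⇒⊆atMost {n = n} {G} G-free ∁∈G {X} X∈G {a} {b} {c} atMost∈G a∉X b∉X c∉X a<b a<c b≢c with X ⊆? atMost a
... | yes X⊆ = X⊆
... | no X⊈ = contradiction (containsK2k-fromAntichain b≢c (∁∈G b) (∁∈G c) g g∈G g-anti g-misses) G-free
  where
  g : Vector (Subset n) 2
  g = X Vector.∷ atMost a Vector.∷ Vector.[]
  g∈G : ∀ i → g i ∈ G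
  g∈G zero = X∈G
  g∈G (suc zero) = atMost∈G
  g-anti : IsAntichain g
  g-anti zero zero _ = refl
  g-anti zero (suc zero) X⊆ = ⊥-elim (X⊈ X⊆)
  g-anti (suc zero) zero ⊆X = contradiction (⊆X (∈-atMost⁺ (ℕₚ.≤-refl {Fin.toℕ a}))) a∉X
  g-anti (suc zero) (suc zero) _ = refl
  g-misses : ∀ i → b ∉ₛ g i × c ∉ₛ g i
  g-misses zero = b∉X , c∉X
  g-misses (suc zero) = (ℕₚ.<⇒≱ a<b ∘ ∈-atMost⁻) , (ℕₚ.<⇒≱ a<c ∘ ∈-atMost⁻)

missingThree-∈⇔< : {G : List (Subset n)} → ¬ ContainsK2k 2 G → (∀ x → ∁ ⁅ x ⁆ ∈ G) →
  (∀ a → atMost a ∈ G) →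
  {X : Subset n} → X ∈ G → ∀ {a b c l} → missing X ≡ a ∷ b ∷ c ∷ l → ∀ {z} → z ∈ₛ X ⇔ z Fin.< a
missingThree-∈⇔< G-free ∁∈G atMost∈G {X} X∈G {a} {b} {c} {l} missing≡ =
  ⊆atMost⇒∈⇔< X⊆ (missing-of (here refl)) least
  where
  sorted : AllPairs Fin._<_ (a ∷ b ∷ c ∷ l)
  sorted = subst (AllPairs Fin._<_) missing≡ (missing-sorted X)
  missing-of : ∀ {z} → z ∈ a ∷ b ∷ c ∷ l → z ∉ₛ X
  missing-of z∈ = ∈-missing⁻ (subst (_ ∈_) (sym missing≡) z∈)
  least : ∀ {z} → z ∉ₛ X → a Fin.≤ z
  least z∉X with subst (_ ∈_) missing≡ (∈-missing⁺ z∉X)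
  ... | here refl = ℕₚ.≤-refl
  ... | there z∈ = ℕₚ.<⇒≤ (All.lookup (AllPairs.head sorted) z∈)
  X⊆ : X ⊆ atMost a
  X⊆ = missingThree⇒⊆atMost G-free ∁∈G X∈G (atMost∈G a)
         (missing-of (here refl)) (missing-of (there (here refl))) (missing-of (there (there (here refl))))
         (All.head (AllPairs.head sorted)) (All.head (All.tail (AllPairs.head sorted)))
         (Fin.<⇒≢ (All.head (AllPairs.head (AllPairs.tail sorted))))

-- For K_{2,2}, a set missing at least three points is determined by the least of them.
leastOrAll : {A : Set} → List A → List A
leastOrAll (a ∷ _ ∷ _ ∷ _) = a ∷ []
leastOrAll l = l

leastOrAll-missing-injective : {G : List (Subset n)} → ¬ ContainsK2k 2 G → (∀ x → ∁ ⁅ x ⁆ ∈ G) →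
  (∀ a → atMost a ∈ G) → {X Y : Subset n} → X ∈ G → Y ∈ G →
  2 ≤ length (missing X) → 2 ≤ length (missing Y) →
  leastOrAll (missing X) ≡ leastOrAll (missing Y) → X ≡ Y
leastOrAll-missing-injective G-free ∁∈G atMost∈G {X} {Y} X∈G Y∈G X-two Y-two eq
  with missing X in missingX≡ | missing Y in missingY≡
... | _ ∷ _ ∷ [] | _ ∷ _ ∷ [] with refl ← eq = missing-injective (trans missingX≡ (sym missingY≡))
... | _ ∷ _ ∷ _ ∷ _ | _ ∷ _ ∷ _ ∷ _ with refl ← eq = ⊆-antisym
  (Equivalence.from (below Y∈G missingY≡) ∘ Equivalence.to (below X∈G missingX≡))
  (Equivalence.from (below X∈G missingX≡) ∘ Equivalence.to (below Y∈G missingY≡))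
  where below = missingThree-∈⇔< G-free ∁∈G atMost∈G
... | _ ∷ _ ∷ [] | _ ∷ _ ∷ _ ∷ _ with () ← eq
... | _ ∷ _ ∷ _ ∷ _ | _ ∷ _ ∷ [] with () ← eq
... | [] | _ with () ← X-two
... | _ ∷ [] | _ with s≤s () ← X-two
... | _ | [] with () ← Y-two
... | _ | _ ∷ [] with s≤s () ← Y-two

missingTwo-length≤-K22 : {G : List (Subset n)} → ¬ ContainsK2k 2 G → (∀ x → ∁ ⁅ x ⁆ ∈ G) →
  (∀ a → atMost a ∈ G) →
  (M : List (Subset n)) → Unique M → (∀ {X} → X ∈ M → X ∈ G) → (∀ {X} → X ∈ M → 2 ≤ length (missing X)) →
  length M ≤ n * n + n
missingTwo-length≤-K22 {n = n} {G} G-free ∁∈G atMost∈G M M-unique M⊆G M-two =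
  subst (length M ≤_) length-codes
    (length≤fibres (List.≡-dec Fin._≟_) (leastOrAll ∘ missing) 1 fibre codes M M-unique
      (λ X∈ → M⊆G X∈ , M-two X∈)
      λ {X} X∈ → code∈ (missing X) (M-two X∈))
  where
  codes : List (List (Fin n))
  codes = pairs n ++ map (_∷ []) (allFin n)
  code∈ : (l : List (Fin n)) → 2 ≤ length l → leastOrAll l ∈ codes
  code∈ l@(_ ∷ _ ∷ []) l-two = ∈-++⁺ˡ (take₂∈pairs l l-two)
  code∈ (a ∷ _ ∷ _ ∷ _) _ = ∈-++⁺ʳ (pairs n) (∈-map⁺ (_∷ []) (∈-allFin a))
  code∈ (_ ∷ []) (s≤s ())
  length-codes : length codes * 1 ≡ n * n + n
  length-codes = trans (ℕₚ.*-identityʳ _)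
    (trans (length-++ (pairs n)) (cong₂ _+_ (length-pairs {n = n}) (trans (length-map _ (allFin n)) (length-tabulate id))))
  fibre : ∀ c N → Unique N → (∀ {X} → X ∈ N → X ∈ G × 2 ≤ length (missing X)) →
    (∀ {X} → X ∈ N → leastOrAll (missing X) ≡ c) → length N ≤ 1
  fibre c N N-unique N-R N-c = length≤1 N N-unique λ X∈ Y∈ →
    leastOrAll-missing-injective G-free ∁∈G atMost∈G (proj₁ (N-R X∈)) (proj₁ (N-R Y∈))
      (proj₂ (N-R X∈)) (proj₂ (N-R Y∈)) (trans (N-c X∈) (sym (N-c Y∈)))

satStar-K2k : (k n : ℕ) → SatStarLe (suc k) n (suc n + n * n * suc n * k)
satStar-K2k k n =
  let G , seed⊆G , G-unique , G-saturated@(G-free , _) =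
        saturate (allSubsets n) ∈-allSubsets (punctured n) (missesAtMostOne⇒K2k-free punctured-missesAtMostOne)
  in G , G-unique , G-saturated ,
     length≤1+n+missingTwo G G-unique (missingTwo-length≤ G-free (seed⊆G ∘ ∁⁅x⁆∈punctured))
  where open Saturation (_≟ₛ_ {n}) (containsK2k? (suc k)) containsInduced-mono

satStar-K22 : (n : ℕ) → SatStarLe 2 n (suc n + (n * n + n))
satStar-K22 n =
  let G , seed⊆G , G-unique , G-saturated@(G-free , _) =
        saturate (allSubsets n) ∈-allSubsets seed (chainOrMissesAtMostOne⇒K2k-free IsAtMost atMost-chain′ seed-shape)
  in G , G-unique , G-saturated ,
     length≤1+n+missingTwo G G-unique (missingTwo-length≤-K22 G-free (seed⊆G ∘ ∈-++⁺ˡ ∘ ∁⁅x⁆∈punctured)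
       (seed⊆G ∘ ∈-++⁺ʳ (punctured n) ∘ ∈-map⁺ atMost ∘ ∈-allFin))
  where
  open Saturation (_≟ₛ_ {n}) (containsK2k? 2) containsInduced-mono
  seed : List (Subset n)
  seed = punctured n ++ map atMost (allFin n)
  IsAtMost : Subset n → Set
  IsAtMost X = ∃ λ a → X ≡ atMost a
  atMost-chain′ : ∀ {X Y} → IsAtMost X → IsAtMost Y → X ⊆ Y ⊎ Y ⊆ X
  atMost-chain′ (a , refl) (b , refl) = atMost-chain a b
  seed-shape : ∀ {X} → X ∈ seed → MissesAtMostOne X ⊎ IsAtMost X
  seed-shape X∈ with ∈-++⁻ (punctured n) X∈
  ... | inj₁ X∈punctured = inj₁ (punctured-missesAtMostOne X∈punctured)
  ... | inj₂ X∈atMosts with ∈-map⁻ atMost X∈atMosts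
  ...   | a , _ , X≡ = inj₂ (a , X≡)

satStarLe-mono : ∀ {k n m m′} → SatStarLe k n m → m ≤ m′ → SatStarLe k n m′
satStarLe-mono (F , F-unique , F-saturated , length≤m) m≤m′ =
  F , F-unique , F-saturated , ℕₚ.≤-trans length≤m m≤m′

1+n≤2*n : 1 ≤ n → suc n ≤ 2 * n
1+n≤2*n {n = n} 1≤n = begin
  suc n  ≡⟨ ℕₚ.+-comm 1 n ⟩
  n + 1  ≤⟨ ℕₚ.+-monoʳ-≤ n 1≤n ⟩
  n + n  ≡⟨ cong (n +_) (sym (ℕₚ.+-identityʳ n)) ⟩
  2 * n  ∎
  where open ℕₚ.≤-Reasoning

n≤n*n : ∀ n → n ≤ n * n
n≤n*n zero = z≤n
n≤n*n n@(suc _) = ℕₚ.m≤m*n n n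

bound-K21 : 1 ≤ n → suc n + n * n * suc n * 0 ≤ 2 * n ^ 1
bound-K21 {n = n} 1≤n = begin
  suc n + n * n * suc n * 0  ≡⟨ trans (cong (suc n +_) (ℕₚ.*-zeroʳ (n * n * suc n))) (ℕₚ.+-identityʳ _) ⟩
  suc n                      ≤⟨ 1+n≤2*n 1≤n ⟩
  2 * n                      ≡⟨ cong (2 *_) (sym (ℕₚ.*-identityʳ n)) ⟩
  2 * n ^ 1                  ∎
  where open ℕₚ.≤-Reasoning

bound-K22 : 1 ≤ n → suc n + (n * n + n) ≤ 4 * n ^ 2
bound-K22 {n = n} 1≤n = begin
  suc n + (n * n + n)            ≤⟨ ℕₚ.+-mono-≤ (1+n≤2*n 1≤n) (ℕₚ.+-monoʳ-≤ (n * n) (n≤n*n n)) ⟩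
  2 * n + (n * n + n * n)        ≤⟨ ℕₚ.+-monoˡ-≤ (n * n + n * n) (ℕₚ.*-monoʳ-≤ 2 (n≤n*n n)) ⟩
  2 * (n * n) + (n * n + n * n)  ≡⟨ square-identity n ⟩
  4 * n ^ 2                      ∎
  where
  open ℕₚ.≤-Reasoning
  square-identity : ∀ n → 2 * (n * n) + (n * n + n * n) ≡ 4 * (n * (n * 1))
  square-identity = solve-∀

bound-K2k : 1 ≤ n → 2 ≤ k → suc n + n * n * suc n * k ≤ 2 * suc k * n ^ suc k
bound-K2k {n = n@(suc _)} {k} 1≤n 2≤k = begin
  suc n + n * n * suc n * k
    ≤⟨ ℕₚ.+-mono-≤ (ℕₚ.≤-trans (1+n≤2*n 1≤n) (ℕₚ.*-monoʳ-≤ 2 n≤n*n*n))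
                   (ℕₚ.*-monoˡ-≤ k (ℕₚ.*-monoʳ-≤ (n * n) (1+n≤2*n 1≤n))) ⟩
  2 * (n * n * n) + n * n * (2 * n) * k  ≡⟨ cube-identity n k ⟩
  2 * suc k * n ^ 3                      ≤⟨ ℕₚ.*-monoʳ-≤ (2 * suc k) (ℕₚ.^-monoʳ-≤ n (s≤s 2≤k)) ⟩
  2 * suc k * n ^ suc k                  ∎
  where
  open ℕₚ.≤-Reasoning
  n≤n*n*n : n ≤ n * n * n
  n≤n*n*n = ℕₚ.≤-trans (n≤n*n n) (ℕₚ.m≤m*n (n * n) n)
  cube-identity : ∀ n k → 2 * (n * n * n) + n * n * (2 * n) * k ≡ 2 * suc k * (n * (n * (n * 1)))
  cube-identity = solve-∀

proposition5 : (k : ℕ) → 1 ≤ k →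
    ∃ λ C → ∃ λ N → (n : ℕ) → N ≤ n → SatStarLe k n (C * n ^ k)
proposition5 1 _ = 2 , 1 , λ n 1≤n → satStarLe-mono (satStar-K2k 0 n) (bound-K21 1≤n)
proposition5 2 _ = 4 , 1 , λ n 1≤n → satStarLe-mono (satStar-K22 n) (bound-K22 1≤n)
proposition5 (suc k@(suc (suc _))) _ =
  2 * suc k , 1 , λ n 1≤n → satStarLe-mono (satStar-K2k k n) (bound-K2k 1≤n (s≤s (s≤s z≤n)))
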